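{- Let $n,k,r,a$ be positive integers such that $rk\leq n$ and $a<r$, and let $\mathcal{H}$ be an $r$-graph on $n$ vertices. If $V(\mathcal{H})$ has $k$ pairwise disjoint $a$-element subsets $A_1,\dots,A_k$ with $\deg_{\mathcal{H}}(A_i)>r(k-1)\binom{n-a-1}{r-a-1}$ for each $i$, then $\mathcal{H}$ contains a matching of size $k$.
   Context: An $r$-graph $\mathcal{H}$ has a finite vertex set $V(\mathcal{H})$ and edge set contained in $\binom{V(\mathcal{H})}{r}$. For $S\subseteq V(\mathcal{H})$ with $|S|<r$, $\deg_{\mathcal{H}}(S)$ is the number of $T\in\binom{V(\mathcal{H})}{r-|S|}$ with $S\cup T$ an edge of $\mathcal{H}$. A matching is a set of pairwise disjoint edges. -}

module Defs where

open import Data.Nat using (ℕ; zero; suc; _∸_)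
open import Data.Nat.Properties using (_≟_)
open import Data.Bool using (Bool; true; _∧_)
open import Data.Fin using (Fin)
open import Data.Fin.Subset using (Subset; ∣_∣; _∪_; _∩_; Empty; inside; outside)
open import Data.List using (List; []; _∷_; _++_; map; filterᵇ; length)
open import Data.Vec using (_∷_; [])
open import Data.Product using (_×_)
open import Relation.Binary.PropositionalEquality using (_≡_; _≢_)
open import Relation.Nullary.Decidable using (⌊_⌋)

allSubsets : (n : ℕ) → List (Subset n)
allSubsets zero = [] ∷ []
allSubsets (suc n) = map (inside ∷_) (allSubsets n) ++ map (outside ∷_) (allSubsets n)

record RGraph (r n : ℕ) : Set where
  field
    edge    : Subset n → Bool
    uniform : ∀ (e : Subset n) → edge e ≡ true → ∣ e ∣ ≡ r
open RGraph public

deg : ∀ {r n} → RGraph r n → Subset n → ℕ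
deg {r} H S =
  length (filterᵇ (λ T → ⌊ ∣ T ∣ ≟ r ∸ ∣ S ∣ ⌋ ∧ edge H (S ∪ T)) (allSubsets _))
IsMatching : ∀ {r n} → RGraph r n → (k : ℕ) → (Fin k → Subset n) → Set
IsMatching H k M =
  (∀ i → edge H (M i) ≡ true) × (∀ i j → i ≢ j → Empty (M i ∩ M j))

module Submission where

-- We treat A₁, …, A_k one at a time, keeping a family M
-- of pairwise disjoint sets in which every member is either already an edge
-- or still the original set A i.  To turn a member M i₀ = A i₀ into an edge
-- we look for a set T in the link of A i₀ (|T| = r - a and A i₀ ∪ T is an
-- edge) that misses the at most r(k-1) vertices V covered by the other
-- members.  A link set is disjoint from A i₀, so the link sets through a
-- fixed vertex v are v together with an (r-a-1)-subset of the n-a-1 vertices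
-- outside A i₀ ∪ {v}: there are at most B = C(n-a-1, r-a-1) of them.  By the
-- union bound at most r(k-1)·B < deg(A i₀) link sets meet V, so T exists.

open import Defs
open import Data.Nat using (ℕ; zero; suc; _+_; _*_; _∸_; _≤_; _<_; _>_; z≤n; s≤s)
open import Data.Nat.Properties
  using (_≟_; ≤-refl; ≤-trans; ≤-reflexive; <-≤-trans; <⇒≤; +-mono-≤; +-monoʳ-≤; *-monoˡ-≤;
         +-assoc; +-comm; +-suc; +-identityʳ; *-comm; +-cancelˡ-≡; +-cancelʳ-<; suc-injective; m≤m+n;
         ∸-+-assoc; m+n∸n≡m; m+[n∸m]≡n; m<n⇒0<n∸m; +-commutativeSemigroup; module ≤-Reasoning)
open import Algebra.Properties.CommutativeSemigroup +-commutativeSemigroup using (interchange)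
open import Data.Nat.Combinatorics using (_C_; nCk+nC[k+1]≡[n+1]C[k+1])
open import Data.Bool using (Bool; true; false; _∧_; not; if_then_else_)
open import Data.Bool.Properties using (T?; ∧-zeroʳ; ∧-identityʳ; ∧-assoc)
open import Data.List using (List; []; _∷_; _++_; map; filterᵇ; length; allFin)
open import Data.List.Properties using (length-++; length-map; filter-++)
open import Data.List.Relation.Unary.Any as Any using ()
open import Data.List.Relation.Unary.All as All using (All; []; _∷_)
open import Data.List.Membership.Propositional using () renaming (_∈_ to _∈ₗ_)
open import Data.List.Membership.Propositional.Properties using (∈-map⁺; ∈-++⁺ˡ; ∈-++⁺ʳ; ∈-allFin)
open import Data.Vec using (Vec; []; _∷_; lookup; here; there)
open import Data.Vec.Properties using ([]=⇒lookup)
open import Data.Vec.Functional using (updateAt)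
open import Data.Vec.Functional.Properties using (updateAt-updates; updateAt-minimal)
open import Data.Fin using (Fin; zero; suc; punchIn; punchOut)
open import Data.Fin.Properties using (punchIn-punchOut) renaming (_≟_ to _≟ᶠ_)
open import Data.Fin.Subset using (Subset; ∣_∣; _∪_; _∩_; Empty; inside; outside; _∈_)
open import Data.Fin.Subset.Properties using (x∈p∩q⁻; x∈p∩q⁺; x∈p∪q⁻; ∩-comm)
open import Data.Product using (Σ; _,_; _×_; proj₁; proj₂)
open import Data.Sum using (_⊎_; inj₁; inj₂)
open import Function using (_∘_; const; id)
open import Relation.Binary.PropositionalEquality
  using (_≡_; _≢_; refl; sym; trans; cong; cong₂; subst; module ≡-Reasoning)
open import Relation.Nullary using (yes; no; contradiction)
open import Relation.Nullary.Decidable using (⌊_⌋)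

∧-true : ∀ {x y} → x ∧ y ≡ true → x ≡ true × y ≡ true
∧-true {true} {true} _ = refl , refl

≟-sound : ∀ {x m} → ⌊ x ≟ m ⌋ ≡ true → x ≡ m
≟-sound {x} {m} ok with x ≟ m
... | yes x≡m = x≡m

≟-suc : ∀ x m → ⌊ suc x ≟ suc m ⌋ ≡ ⌊ x ≟ m ⌋
≟-suc x m with x ≟ m | suc x ≟ suc m
... | yes _   | yes _    = refl
... | no _    | no _     = refl
... | yes x≡m | no x≢m   = contradiction (cong suc x≡m) x≢m
... | no x≢m  | yes x≡m  = contradiction (suc-injective x≡m) x≢m

count : ∀ {n} → (Subset n → Bool) → ℕ
count {zero}  p = if p [] then 1 else 0
count {suc n} p = count (λ t → p (inside ∷ t)) + count (λ t → p (outside ∷ t))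

length-filter-map : ∀ {A B : Set} (p : B → Bool) (f : A → B) (xs : List A) →
  length (filterᵇ p (map f xs)) ≡ length (filterᵇ (p ∘ f) xs)
length-filter-map p f [] = refl
length-filter-map p f (x ∷ xs) with p (f x)
... | true  = cong suc (length-filter-map p f xs)
... | false = length-filter-map p f xs

count-allSubsets : ∀ n (p : Subset n → Bool) → length (filterᵇ p (allSubsets n)) ≡ count p
count-allSubsets zero p with p []
... | true  = refl
... | false = refl
count-allSubsets (suc n) p = begin
    length (filterᵇ p (ins ++ outs))
  ≡⟨ cong length (filter-++ (T? ∘ p) ins outs) ⟩
    length (filterᵇ p ins ++ filterᵇ p outs)
  ≡⟨ length-++ (filterᵇ p ins) ⟩
    length (filterᵇ p ins) + length (filterᵇ p outs)
  ≡⟨ cong₂ _+_ (half inside) (half outside) ⟩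
    count p
  ∎
  where
  open ≡-Reasoning
  ins outs : List (Subset (suc n))
  ins  = map (inside ∷_) (allSubsets n)
  outs = map (outside ∷_) (allSubsets n)
  half : ∀ b → length (filterᵇ p (map (b ∷_) (allSubsets n))) ≡ count (λ t → p (b ∷ t))
  half b = trans (length-filter-map p (b ∷_) (allSubsets n)) (count-allSubsets n _)

count-cong : ∀ {n} {p q : Subset n → Bool} → (∀ t → p t ≡ q t) → count p ≡ count q
count-cong {zero}  h rewrite h [] = refl
count-cong {suc n} h = cong₂ _+_ (count-cong (h ∘ (inside ∷_))) (count-cong (h ∘ (outside ∷_)))

count-mono : ∀ {n} {p q : Subset n → Bool} → (∀ t → p t ≡ true → q t ≡ true) → count p ≤ count q
count-mono {zero} {p} h with p [] in p[]
... | false = z≤n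
... | true rewrite h [] p[] = ≤-refl
count-mono {suc n} h = +-mono-≤ (count-mono (h ∘ (inside ∷_))) (count-mono (h ∘ (outside ∷_)))

count-none : ∀ {n} (p : Subset n → Bool) → (∀ t → p t ≡ false) → count p ≡ 0
count-none {zero}  p h rewrite h [] = refl
count-none {suc n} p h = cong₂ _+_ (count-none _ (h ∘ (inside ∷_))) (count-none _ (h ∘ (outside ∷_)))

count-split : ∀ {n} (p b : Subset n → Bool) →
  count p ≡ count (λ t → p t ∧ not (b t)) + count (λ t → p t ∧ b t)
count-split {zero} p b with p [] | b []
... | true  | true  = refl
... | true  | false = refl
... | false | _     = refl
count-split {suc n} p b =
  trans (cong₂ _+_ (count-split (p ∘ (inside ∷_)) (b ∘ (inside ∷_)))
                   (count-split (p ∘ (outside ∷_)) (b ∘ (outside ∷_))))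
        (interchange (part inside not) (part inside id) (part outside not) (part outside id))
  where
  part : Bool → (Bool → Bool) → ℕ
  part x f = count (λ t → p (x ∷ t) ∧ f (b (x ∷ t)))

count-witness : ∀ {n} (p : Subset n → Bool) → 0 < count p → Σ (Subset n) (λ t → p t ≡ true)
count-witness {zero} p pos with p [] in p[]
... | true = [] , p[]
count-witness {suc n} p pos with count (λ t → p (inside ∷ t)) in c
... | suc _ with count-witness (p ∘ (inside ∷_)) (subst (0 <_) (sym c) (s≤s z≤n))
...   | t , pt = inside ∷ t , pt
count-witness {suc n} p pos | zero with count-witness (p ∘ (outside ∷_)) pos
...   | t , pt = outside ∷ t , pt


data Constraint : Set where
  required forbidden free : Constraint

Pattern : ℕ → Set
Pattern = Vec Constraint

matches : ∀ {n} → Pattern n → Subset n → Bool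
matches []                []      = true
matches (required  ∷ P) (x ∷ t) = x ∧ matches P t
matches (forbidden ∷ P) (x ∷ t) = not x ∧ matches P t
matches (free      ∷ P) (_ ∷ t) = matches P t

#required #free : ∀ {n} → Pattern n → ℕ
#required []               = 0
#required (required ∷ P) = suc (#required P)
#required (_        ∷ P) = #required P
#free []           = 0
#free (free ∷ P) = suc (#free P)
#free (_    ∷ P) = #free P

sized : ∀ {n} → ℕ → Pattern n → Subset n → Bool
sized m P T = ⌊ ∣ T ∣ ≟ m ⌋ ∧ matches P T

-- The number of m-sets containing y prescribed elements whose other
-- elements are chosen among f free ones: C(f, m - y) if y ≤ m, else 0.
pinnedChoose : ℕ → ℕ → ℕ → ℕ
pinnedChoose f zero    m       = f C m
pinnedChoose f (suc y) zero    = 0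
pinnedChoose f (suc y) (suc m) = pinnedChoose f y m

pinnedChoose-zero : ∀ f y → pinnedChoose f y 0 ≡ pinnedChoose (suc f) y 0
pinnedChoose-zero f zero    = refl
pinnedChoose-zero f (suc y) = refl

-- Pascal's rule: a new free element is either left out or taken.
pinnedChoose-pascal : ∀ f y m →
  pinnedChoose f y m + pinnedChoose f y (suc m) ≡ pinnedChoose (suc f) y (suc m)
pinnedChoose-pascal f zero    m       = nCk+nC[k+1]≡[n+1]C[k+1] f m
pinnedChoose-pascal f (suc y) zero    = pinnedChoose-zero f y
pinnedChoose-pascal f (suc y) (suc m) = pinnedChoose-pascal f y m

pinnedChoose-one : ∀ f m → 0 < m → pinnedChoose f 1 m ≡ f C (m ∸ 1)
pinnedChoose-one f (suc m) _ = refl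

count-pattern : ∀ {n} (P : Pattern n) m → count (sized m P) ≡ pinnedChoose (#free P) (#required P) m
count-pattern [] zero    = refl
count-pattern [] (suc m) = refl
count-pattern (required ∷ P) zero =
  cong₂ _+_ (count-none (sized 0 (required ∷ P) ∘ (inside ∷_)) (λ _ → refl))
            (count-none (sized 0 (required ∷ P) ∘ (outside ∷_)) (λ t → ∧-zeroʳ _))
count-pattern (required ∷ P) (suc m) =
  trans (cong₂ _+_ (shift P m) (count-none (sized (suc m) (required ∷ P) ∘ (outside ∷_)) (λ t → ∧-zeroʳ _)))
        (trans (+-identityʳ _) (count-pattern P m))
  where
  shift : ∀ {n} (P : Pattern n) m →
    count (λ t → ⌊ suc ∣ t ∣ ≟ suc m ⌋ ∧ matches P t) ≡ count (sized m P)
  shift P m = count-cong (λ t → cong (_∧ matches P t) (≟-suc ∣ t ∣ m))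
count-pattern (forbidden ∷ P) m =
  cong₂ _+_ (count-none (sized m (forbidden ∷ P) ∘ (inside ∷_)) (λ t → ∧-zeroʳ _)) (count-pattern P m)
count-pattern (free ∷ P) zero =
  trans (cong₂ _+_ (count-none (sized 0 (free ∷ P) ∘ (inside ∷_)) (λ _ → refl)) (count-pattern P zero))
        (pinnedChoose-zero (#free P) (#required P))
count-pattern (free ∷ P) (suc m) =
  trans (cong₂ _+_ (trans (count-cong (λ t → cong (_∧ matches P t) (≟-suc ∣ t ∣ m)))
                          (count-pattern P m))
                   (count-pattern P (suc m)))
        (pinnedChoose-pascal (#free P) (#required P) m)


link : ∀ {r n} → RGraph r n → Subset n → Subset n → Bool
link {r} H S T = ⌊ ∣ T ∣ ≟ r ∸ ∣ S ∣ ⌋ ∧ edge H (S ∪ T)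

deg≡count-link : ∀ {r n} (H : RGraph r n) S → deg H S ≡ count (link H S)
deg≡count-link {n = n} H S = count-allSubsets n (link H S)

∣∪∣+∣∩∣ : ∀ {n} (S T : Subset n) → ∣ S ∪ T ∣ + ∣ S ∩ T ∣ ≡ ∣ S ∣ + ∣ T ∣
∣∪∣+∣∩∣ [] [] = refl
∣∪∣+∣∩∣ (true  ∷ S) (true  ∷ T) = cong suc (trans (+-suc _ _) (trans (cong suc (∣∪∣+∣∩∣ S T)) (sym (+-suc _ _))))
∣∪∣+∣∩∣ (true  ∷ S) (false ∷ T) = cong suc (∣∪∣+∣∩∣ S T)
∣∪∣+∣∩∣ (false ∷ S) (true  ∷ T) = trans (cong suc (∣∪∣+∣∩∣ S T)) (sym (+-suc _ _))
∣∪∣+∣∩∣ (false ∷ S) (false ∷ T) = ∣∪∣+∣∩∣ S T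

-- A link set is disjoint from S, as the r-edge S ∪ T has |S| + |T| = r elements.
link-disjoint : ∀ {r n} (H : RGraph r n) {S T} → ∣ S ∣ ≤ r → link H S T ≡ true → ∣ S ∩ T ∣ ≡ 0
link-disjoint {r} H {S} {T} S≤r inLink = +-cancelˡ-≡ r _ _ (begin
    r + ∣ S ∩ T ∣             ≡⟨ cong (_+ ∣ S ∩ T ∣) (sym (uniform H (S ∪ T) isEdge)) ⟩
    ∣ S ∪ T ∣ + ∣ S ∩ T ∣     ≡⟨ ∣∪∣+∣∩∣ S T ⟩
    ∣ S ∣ + ∣ T ∣             ≡⟨ cong (∣ S ∣ +_) (≟-sound sizeOk) ⟩
    ∣ S ∣ + (r ∸ ∣ S ∣)       ≡⟨ m+[n∸m]≡n S≤r ⟩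
    r                         ≡⟨ sym (+-identityʳ r) ⟩
    r + 0                     ∎)
  where
  open ≡-Reasoning
  sizeOk : ⌊ ∣ T ∣ ≟ r ∸ ∣ S ∣ ⌋ ≡ true
  sizeOk = proj₁ (∧-true inLink)
  isEdge : edge H (S ∪ T) ≡ true
  isEdge = proj₂ (∧-true inLink)

disjoint-lookup : ∀ {n} (S T : Subset n) v → ∣ S ∩ T ∣ ≡ 0 → lookup S v ≡ true → lookup T v ≡ false
disjoint-lookup (true  ∷ S) (false ∷ T) zero    _ _  = refl
disjoint-lookup (true  ∷ S) (false ∷ T) (suc v) h sv = disjoint-lookup S T v h sv
disjoint-lookup (false ∷ S) (b     ∷ T) (suc v) h sv = disjoint-lookup S T v h sv

outsidePattern : ∀ {n} → Subset n → Pattern n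
outsidePattern []      = []
outsidePattern (x ∷ S) = (if x then forbidden else free) ∷ outsidePattern S

throughPattern : ∀ {n} → Subset n → Fin n → Pattern n
throughPattern (x ∷ S) zero    = (if x then forbidden else required) ∷ outsidePattern S
throughPattern (x ∷ S) (suc v) = (if x then forbidden else free) ∷ throughPattern S v

matches-outside : ∀ {n} (S T : Subset n) → ∣ S ∩ T ∣ ≡ 0 → matches (outsidePattern S) T ≡ true
matches-outside []          []          _ = refl
matches-outside (true  ∷ S) (false ∷ T) h = matches-outside S T h
matches-outside (false ∷ S) (_     ∷ T) h = matches-outside S T h

matches-through : ∀ {n} (S T : Subset n) v → ∣ S ∩ T ∣ ≡ 0 → lookup T v ≡ true →
  matches (throughPattern S v) T ≡ true
matches-through (false ∷ S) (_     ∷ T) zero    h tv = cong₂ _∧_ tv (matches-outside S T h)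
matches-through (true  ∷ S) (false ∷ T) (suc v) h tv = matches-through S T v h tv
matches-through (false ∷ S) (_     ∷ T) (suc v) h tv = matches-through S T v h tv

outsidePattern-counts : ∀ {n} (S : Subset n) →
  #required (outsidePattern S) ≡ 0 × #free (outsidePattern S) + ∣ S ∣ ≡ n
outsidePattern-counts [] = refl , refl
outsidePattern-counts (true ∷ S) with outsidePattern-counts S
... | req , fr = req , trans (+-suc _ _) (cong suc fr)
outsidePattern-counts (false ∷ S) with outsidePattern-counts S
... | req , fr = req , cong suc fr

throughPattern-counts : ∀ {n} (S : Subset n) v → lookup S v ≡ false →
  #required (throughPattern S v) ≡ 1 × #free (throughPattern S v) + suc ∣ S ∣ ≡ n
throughPattern-counts (false ∷ S) zero _ with outsidePattern-counts S
... | req , fr = cong suc req , trans (+-suc _ _) (cong suc fr)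
throughPattern-counts (true ∷ S) (suc v) sv with throughPattern-counts S v sv
... | req , fr = req , trans (+-suc _ _) (cong suc fr)
throughPattern-counts (false ∷ S) (suc v) sv with throughPattern-counts S v sv
... | req , fr = req , cong suc fr

sum-cancel : ∀ f s n → f + suc s ≡ n → f ≡ n ∸ s ∸ 1
sum-cancel f s n eq = begin
  f                ≡⟨ sym (m+n∸n≡m f (suc s)) ⟩
  f + suc s ∸ suc s ≡⟨ cong (_∸ suc s) eq ⟩
  n ∸ suc s        ≡⟨ cong (n ∸_) (+-comm 1 s) ⟩
  n ∸ (s + 1)      ≡⟨ sym (∸-+-assoc n s 1) ⟩
  n ∸ s ∸ 1        ∎
  where open ≡-Reasoning

link-through-bound : ∀ {r n a} (H : RGraph r n) {S : Subset n} → ∣ S ∣ ≡ a → a < r → ∀ v →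
  count (λ T → link H S T ∧ lookup T v) ≤ (n ∸ a ∸ 1) C (r ∸ a ∸ 1)
link-through-bound {r} {n} H {S} refl s<r v with lookup S v in sv
... | true = subst (_≤ _) (sym (count-none _ missesV)) z≤n
  where
  missesV : ∀ T → link H S T ∧ lookup T v ≡ false
  missesV T with link H S T in inLink
  ... | false = refl
  ... | true  = disjoint-lookup S T v (link-disjoint H (<⇒≤ s<r) inLink) sv
... | false = begin
    count (λ T → link H S T ∧ lookup T v)          ≤⟨ count-mono intoPattern ⟩
    count (sized (r ∸ s) P)                          ≡⟨ count-pattern P (r ∸ s) ⟩
    pinnedChoose (#free P) (#required P) (r ∸ s)     ≡⟨ cong (λ y → pinnedChoose (#free P) y (r ∸ s)) req ⟩
    pinnedChoose (#free P) 1 (r ∸ s)                 ≡⟨ pinnedChoose-one (#free P) (r ∸ s) (m<n⇒0<n∸m s<r) ⟩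
    #free P C (r ∸ s ∸ 1)                            ≡⟨ cong (_C (r ∸ s ∸ 1)) (sum-cancel (#free P) s n fr) ⟩
    (n ∸ s ∸ 1) C (r ∸ s ∸ 1)                        ∎
  where
  open ≤-Reasoning
  s : ℕ
  s = ∣ S ∣
  P : Pattern n
  P = throughPattern S v
  req : #required P ≡ 1
  req = proj₁ (throughPattern-counts S v sv)
  fr : #free P + suc s ≡ n
  fr = proj₂ (throughPattern-counts S v sv)
  intoPattern : ∀ T → link H S T ∧ lookup T v ≡ true → sized (r ∸ s) P T ≡ true
  intoPattern T ok with ∧-true ok
  ... | inLink , tv =
    cong₂ _∧_ (proj₁ (∧-true inLink)) (matches-through S T v (link-disjoint H (<⇒≤ s<r) inLink) tv)


avoids : ∀ {n} → List (Fin n) → Subset n → Bool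
avoids []      T = true
avoids (v ∷ L) T = not (lookup T v) ∧ avoids L T

avoids-sound : ∀ {n} (L : List (Fin n)) T → avoids L T ≡ true → ∀ {v} → v ∈ₗ L → lookup T v ≡ false
avoids-sound (w ∷ L) T ok (Any.here refl) with lookup T w
... | false = refl
avoids-sound (w ∷ L) T ok (Any.there v∈L) with lookup T w
... | false = avoids-sound L T ok v∈L

count-avoiding : ∀ {n} B (L : List (Fin n)) (p : Subset n → Bool) →
  (∀ v → count (λ T → p T ∧ lookup T v) ≤ B) →
  count p ≤ count (λ T → p T ∧ avoids L T) + length L * B
count-avoiding B [] p through =
  ≤-trans (≤-reflexive (count-cong (λ T → sym (∧-identityʳ (p T))))) (m≤m+n _ _)
count-avoiding {n} B (v ∷ L) p through = begin
    count p
  ≡⟨ count-split p (λ T → lookup T v) ⟩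
    count p' + count (λ T → p T ∧ lookup T v)
  ≤⟨ +-mono-≤ (count-avoiding B L p' through') (through v) ⟩
    count (λ T → p' T ∧ avoids L T) + length L * B + B
  ≡⟨ cong (λ c → c + length L * B + B) (count-cong (λ T → ∧-assoc (p T) _ _)) ⟩
    count (λ T → p T ∧ avoids (v ∷ L) T) + length L * B + B
  ≡⟨ trans (+-assoc c (length L * B) B) (cong (c +_) (+-comm (length L * B) B)) ⟩
    count (λ T → p T ∧ avoids (v ∷ L) T) + length (v ∷ L) * B
  ∎
  where
  open ≤-Reasoning
  p' : Subset n → Bool
  p' T = p T ∧ not (lookup T v)
  c : ℕ
  c = count (λ T → p T ∧ avoids (v ∷ L) T)
  drop-middle : ∀ x y z → (x ∧ not y) ∧ z ≡ true → x ∧ z ≡ true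
  drop-middle true false true _ = refl
  through' : ∀ w → count (λ T → p' T ∧ lookup T w) ≤ B
  through' w = ≤-trans (count-mono (λ T → drop-middle (p T) (lookup T v) (lookup T w))) (through w)


elements : ∀ {n} → Subset n → List (Fin n)
elements []          = []
elements (true  ∷ S) = zero ∷ map suc (elements S)
elements (false ∷ S) = map suc (elements S)

length-elements : ∀ {n} (S : Subset n) → length (elements S) ≡ ∣ S ∣
length-elements []          = refl
length-elements (true  ∷ S) = cong suc (trans (length-map suc (elements S)) (length-elements S))
length-elements (false ∷ S) = trans (length-map suc (elements S)) (length-elements S)

elements-complete : ∀ {n} (S : Subset n) {x} → x ∈ S → x ∈ₗ elements S
elements-complete (true  ∷ S) here      = Any.here refl
elements-complete (true  ∷ S) (there p) = Any.there (∈-map⁺ suc (elements-complete S p))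
elements-complete (false ∷ S) (there p) = ∈-map⁺ suc (elements-complete S p)

coveredBy : ∀ {m n} → (Fin m → Subset n) → List (Fin n)
coveredBy {zero}  F = []
coveredBy {suc m} F = elements (F zero) ++ coveredBy (F ∘ suc)

length-coveredBy : ∀ {m n} r (F : Fin m → Subset n) → (∀ j → ∣ F j ∣ ≤ r) → length (coveredBy F) ≤ m * r
length-coveredBy {zero}  r F small = z≤n
length-coveredBy {suc m} {n} r F small = begin
    length (elements (F zero) ++ rest)
  ≡⟨ length-++ (elements (F zero)) ⟩
    length (elements (F zero)) + length rest
  ≡⟨ cong (_+ length rest) (length-elements (F zero)) ⟩
    ∣ F zero ∣ + length rest
  ≤⟨ +-mono-≤ (small zero) (length-coveredBy r (F ∘ suc) (small ∘ suc)) ⟩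
    r + m * r
  ∎
  where
  open ≤-Reasoning
  rest : List (Fin n)
  rest = coveredBy (F ∘ suc)

coveredBy-complete : ∀ {m n} (F : Fin m → Subset n) j {x} → x ∈ F j → x ∈ₗ coveredBy F
coveredBy-complete {suc m} F zero    x∈F = ∈-++⁺ˡ (elements-complete (F zero) x∈F)
coveredBy-complete {suc m} F (suc j) x∈F = ∈-++⁺ʳ (elements (F zero)) (coveredBy-complete (F ∘ suc) j x∈F)

coveredExcept : ∀ {m n} → (Fin m → Subset n) → Fin m → List (Fin n)
coveredExcept {suc m} F i₀ = coveredBy (F ∘ punchIn i₀)

length-coveredExcept : ∀ {m n} r (F : Fin m → Subset n) i₀ → (∀ j → ∣ F j ∣ ≤ r) →
  length (coveredExcept F i₀) ≤ r * (m ∸ 1)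
length-coveredExcept {suc m} r F i₀ small =
  subst (length (coveredBy (F ∘ punchIn i₀)) ≤_) (*-comm m r)
        (length-coveredBy r (F ∘ punchIn i₀) (small ∘ punchIn i₀))

coveredExcept-complete : ∀ {m n} (F : Fin m → Subset n) i₀ {i x} → i ≢ i₀ → x ∈ F i →
  x ∈ₗ coveredExcept F i₀
coveredExcept-complete {suc m} F i₀ {i} i≢i₀ x∈F =
  coveredBy-complete (F ∘ punchIn i₀) (punchOut i₀≢i)
    (subst (λ j → _ ∈ F j) (sym (punchIn-punchOut i₀≢i)) x∈F)
  where
  i₀≢i : i₀ ≢ i
  i₀≢i = i≢i₀ ∘ sym


Disjoint : ∀ {m n} → (Fin m → Subset n) → Set
Disjoint F = ∀ i j → i ≢ j → Empty (F i ∩ F j)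

Empty-∩-sym : ∀ {n} (X Y : Subset n) → Empty (X ∩ Y) → Empty (Y ∩ X)
Empty-∩-sym X Y = subst Empty (∩-comm X Y)

replace-disjoint : ∀ {m n} {F : Fin m → Subset n} i₀ {e} →
  Disjoint F → (∀ j → j ≢ i₀ → Empty (e ∩ F j)) → Disjoint (updateAt F i₀ (const e))
replace-disjoint {F = F} i₀ {e} disj fresh i j i≢j with i ≟ᶠ i₀ | j ≟ᶠ i₀
... | yes refl | yes refl = contradiction refl i≢j
... | yes refl | no j≢i₀
  rewrite updateAt-updates i₀ {const e} F | updateAt-minimal j i₀ {const e} F j≢i₀ = fresh j j≢i₀
... | no i≢i₀ | yes refl
  rewrite updateAt-updates i₀ {const e} F | updateAt-minimal i i₀ {const e} F i≢i₀ =
  Empty-∩-sym e (F i) (fresh i i≢i₀)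
... | no i≢i₀ | no j≢i₀
  rewrite updateAt-minimal i i₀ {const e} F i≢i₀ | updateAt-minimal j i₀ {const e} F j≢i₀ = disj i j i≢j

updateAt-elim : ∀ {A : Set} {m} (P : Fin m → A → Set) (F : Fin m → A) i₀ {e} →
  P i₀ e → (∀ i → i ≢ i₀ → P i (F i)) → ∀ i → P i (updateAt F i₀ (const e) i)
updateAt-elim P F i₀ {e} pe pF i with i ≟ᶠ i₀
... | yes refl = subst (P i₀) (sym (updateAt-updates i₀ F)) pe
... | no i≢i₀  = subst (P i) (sym (updateAt-minimal i i₀ F i≢i₀)) (pF i i≢i₀)


module Greedy {n k r a : ℕ} (H : RGraph r n) (A : Fin k → Subset n)
  (a<r : a < r)
  (sizeA : ∀ i → ∣ A i ∣ ≡ a)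
  (disjA : Disjoint A)
  (degA : ∀ i → deg H (A i) > r * (k ∸ 1) * ((n ∸ a ∸ 1) C (r ∸ a ∸ 1))) where

  IsEdge : Subset n → Set
  IsEdge e = edge H e ≡ true

  Partial : (Fin k → Subset n) → Set
  Partial M = Disjoint M × (∀ i → IsEdge (M i) ⊎ M i ≡ A i)

  member-size : ∀ {M} → Partial M → ∀ i → ∣ M i ∣ ≤ r
  member-size {M} (_ , status) i with status i
  ... | inj₁ isEdge = ≤-reflexive (uniform H (M i) isEdge)
  ... | inj₂ M≡A    = subst (λ X → ∣ X ∣ ≤ r) (sym M≡A) (subst (_≤ r) (sym (sizeA i)) (<⇒≤ a<r))

  linkSetAvoiding : ∀ i (L : List (Fin n)) → length L ≤ r * (k ∸ 1) →
    Σ (Subset n) (λ T → link H (A i) T ∧ avoids L T ≡ true)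
  linkSetAvoiding i L short = count-witness _ (+-cancelʳ-< _ 0 _ (<-≤-trans degree union))
    where
    B : ℕ
    B = (n ∸ a ∸ 1) C (r ∸ a ∸ 1)
    degree : r * (k ∸ 1) * B < count (link H (A i))
    degree = subst (r * (k ∸ 1) * B <_) (deg≡count-link H (A i)) (degA i)
    union : count (link H (A i)) ≤ count (λ T → link H (A i) T ∧ avoids L T) + r * (k ∸ 1) * B
    union = ≤-trans (count-avoiding B L (link H (A i)) (link-through-bound H (sizeA i) a<r))
                    (+-monoʳ-≤ _ (*-monoˡ-≤ B short))

  extension : ∀ {M} → Partial M → ∀ i₀ → M i₀ ≡ A i₀ →
    Σ (Subset n) (λ e → IsEdge e × (∀ j → j ≢ i₀ → Empty (e ∩ M j)))
  extension {M} partial@(disj , _) i₀ M≡A = A i₀ ∪ T , isEdge , fresh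
    where
    L : List (Fin n)
    L = coveredExcept M i₀
    found : Σ (Subset n) (λ T → link H (A i₀) T ∧ avoids L T ≡ true)
    found = linkSetAvoiding i₀ L (length-coveredExcept r M i₀ (member-size partial))
    T : Subset n
    T = proj₁ found
    inLink : link H (A i₀) T ≡ true
    inLink = proj₁ (∧-true {link H (A i₀) T} (proj₂ found))
    avoidsL : avoids L T ≡ true
    avoidsL = proj₂ (∧-true {link H (A i₀) T} (proj₂ found))
    isEdge : IsEdge (A i₀ ∪ T)
    isEdge = proj₂ (∧-true {⌊ ∣ T ∣ ≟ r ∸ ∣ A i₀ ∣ ⌋} inLink)
    fresh : ∀ j → j ≢ i₀ → Empty ((A i₀ ∪ T) ∩ M j)
    fresh j j≢i₀ (x , x∈e∩Mj) with x∈p∩q⁻ (A i₀ ∪ T) (M j) x∈e∩Mj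
    ... | x∈e , x∈Mj with x∈p∪q⁻ (A i₀) T x∈e
    ...   | inj₁ x∈A = disj i₀ j (j≢i₀ ∘ sym) (x , x∈p∩q⁺ (subst (x ∈_) (sym M≡A) x∈A , x∈Mj))
    ...   | inj₂ x∈T = contradiction (trans (sym ([]=⇒lookup x∈T)) (avoids-sound L T avoidsL
                          (coveredExcept-complete M i₀ j≢i₀ x∈Mj))) (λ ())

  augment : ∀ {M} → Partial M → ∀ i₀ →
    Σ (Fin k → Subset n) (λ M' → Partial M' × IsEdge (M' i₀) × (∀ {i} → IsEdge (M i) → IsEdge (M' i)))
  augment {M} partial@(disj , status) i₀ with status i₀
  ... | inj₁ isEdge = M , partial , isEdge , (λ e → e)
  ... | inj₂ M≡A with extension partial i₀ M≡A
  ...   | e , isEdge , fresh =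
    M' , (replace-disjoint i₀ disj fresh , status') , subst IsEdge (sym (updateAt-updates i₀ M)) isEdge , keeps _
    where
    M' : Fin k → Subset n
    M' = updateAt M i₀ (const e)
    status' : ∀ i → IsEdge (M' i) ⊎ M' i ≡ A i
    status' = updateAt-elim (λ i X → IsEdge X ⊎ X ≡ A i) M i₀ (inj₁ isEdge) (λ i _ → status i)
    keeps : ∀ i → IsEdge (M i) → IsEdge (M' i)
    keeps = updateAt-elim (λ i X → IsEdge (M i) → IsEdge X) M i₀ (const isEdge) (λ _ _ e → e)

  greedy : (js : List (Fin k)) → Σ (Fin k → Subset n) (λ M → Partial M × All (IsEdge ∘ M) js)
  greedy [] = A , (disjA , λ i → inj₂ refl) , []
  greedy (j ∷ js) with greedy js
  ... | M , partial , edges with augment partial j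
  ...   | M' , partial' , edge-j , keeps = M' , partial' , edge-j ∷ All.map keeps edges

lemma3p3 : (n k r a : ℕ) → 1 ≤ n → 1 ≤ k → 1 ≤ r → 1 ≤ a →
    r * k ≤ n → a < r →
    (H : RGraph r n) →
    (A : Fin k → Subset n) →
    (∀ i → ∣ A i ∣ ≡ a) →
    (∀ i j → i ≢ j → Empty (A i ∩ A j)) →
    (∀ i → deg H (A i) > r * (k ∸ 1) * ((n ∸ a ∸ 1) C (r ∸ a ∸ 1))) →
    Σ (Fin k → Subset n) (λ M → IsMatching H k M)
-- Run the greedy construction over all indices.
lemma3p3 n k r a _ _ _ _ _ a<r H A sizeA disjA degA with greedy (allFin k)
  where open Greedy H A a<r sizeA disjA degA
... | M , (disjM , _) , edges = M , (λ i → All.lookup edges (∈-allFin i)) , disjM
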